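{- Let $\overrightarrow{G}$ be a 2-qBMG in which no two symmetric edges have a common endpoint. Then every orientation of $\overrightarrow{G}$ is a 2-qBMG (with the same color classes).
   Context: A digraph $\overrightarrow{G}=\overrightarrow{G}(V,E)$ has a finite vertex set $V$ and edge set $E\subseteq V\times V$ without loops ($uv$ denotes the edge with tail $u$ and head $v$); a symmetric edge is a pair $\{uv,vu\}\subseteq E$, with endpoints $u,v$. $N^+(v)=\{w:vw\in E\}$. Two vertices $u,v$ are independent if neither $uv$ nor $vu$ is in $E$. A 2-qBMG is a digraph, equipped with a partition $V=U\cup W$ into two color classes such that every edge joins a vertex of $U$ and a vertex of $W$, satisfying: (N1) if $u,v$ are independent then there are no vertices $w,t$ with $ut,vw,tw\in E$; (N2) if $uv,vw,wt\in E$ then $ut\in E$; (N3) if $u,v$ have a common out-neighbor then $N^+(u)\subseteq N^+(v)$ or $N^+(v)\subseteq N^+(u)$. An orientation of $\overrightarrow{G}$ is a digraph on the same vertex set obtained from $\overrightarrow{G}$ by keeping every non-symmetric edge and retaining exactly one of the two edges $uv,vu$ from each symmetric edge. -}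

module Defs where

open import Data.Nat using (ℕ)
open import Data.Fin using (Fin)
open import Data.Bool using (Bool; true; false)
open import Data.Product using (_×_; ∃-syntax)
open import Data.Sum using (_⊎_)
open import Relation.Binary.PropositionalEquality using (_≡_; _≢_)
open import Relation.Nullary using (¬_)

Digraph : ℕ → Set
Digraph n = Fin n → Fin n → Bool

Edge : ∀ {n} → Digraph n → Fin n → Fin n → Set
Edge G u v = G u v ≡ true

Loopless : ∀ {n} → Digraph n → Set
Loopless G = ∀ v → ¬ Edge G v v

-- a 2-colouring: the partition V = U ∪ W (U = colour true, W = colour false)
Coloring : ℕ → Set
Coloring n = Fin n → Bool

ProperlyColored : ∀ {n} → Digraph n → Coloring n → Set
ProperlyColored G c = ∀ u v → Edge G u v → c u ≢ c v

-- w ∈ N⁺(v)  is  Edge G v w ;  N⁺(u) ⊆ N⁺(v)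
OutSubset : ∀ {n} → Digraph n → Fin n → Fin n → Set
OutSubset G u v = ∀ w → Edge G u w → Edge G v w

Independent : ∀ {n} → Digraph n → Fin n → Fin n → Set
Independent G u v = ¬ Edge G u v × ¬ Edge G v u

N1 : ∀ {n} → Digraph n → Set
N1 G = ∀ u v → Independent G u v →
       ¬ (∃[ w ] ∃[ t ] (Edge G u t × Edge G v w × Edge G t w))

N2 : ∀ {n} → Digraph n → Set
N2 G = ∀ u v w t → Edge G u v → Edge G v w → Edge G w t → Edge G u t

N3 : ∀ {n} → Digraph n → Set
N3 G = ∀ u v → (∃[ w ] (Edge G u w × Edge G v w)) →
       OutSubset G u v ⊎ OutSubset G v u

Is2qBMG : ∀ {n} → Digraph n → Coloring n → Set
Is2qBMG G c = Loopless G × ProperlyColored G c × N1 G × N2 G × N3 G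

Symmetric : ∀ {n} → Digraph n → Fin n → Fin n → Set
Symmetric G u v = Edge G u v × Edge G v u

NoAdjacentSymmetric : ∀ {n} → Digraph n → Set
NoAdjacentSymmetric G = ∀ u v w → Symmetric G u v → Symmetric G u w → v ≡ w

IsOrientation : ∀ {n} → Digraph n → Digraph n → Set
IsOrientation G O =
  (∀ u v → Edge O u v → Edge G u v) ×
  (∀ u v → Edge G u v → ¬ Edge G v u → Edge O u v) ×
  (∀ u v → Symmetric G u v →
     (Edge O u v × ¬ Edge O v u) ⊎ (Edge O v u × ¬ Edge O u v))

{-# OPTIONS --safe #-}
-- An orientation only removes one edge from each symmetric pair, so looplessness
-- and the colouring pass to it, and it has the same independent pairs, which gives
-- (N1). For (N2) and (N3) the only possible failure is an edge u → t of the
-- original graph that the orientation dropped; its reverse t → u then closes a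
-- directed 4-cycle, and (N2) in the original graph turns that 4-cycle into two
-- symmetric edges with a common endpoint, which is excluded.
module Submission where

open import Defs
open import Data.Nat using (ℕ)
open import Data.Fin using (Fin)
open import Data.Fin.Properties using (any?)
open import Data.Bool using (true; _≟_)
open import Data.Product using (_×_; _,_; proj₁; proj₂; ∃-syntax)
open import Data.Sum using (_⊎_; inj₁; inj₂; swap)
open import Relation.Binary.PropositionalEquality using (_≡_; subst)
open import Relation.Nullary using (¬_; Dec; yes; no; contradiction)
open import Relation.Nullary.Decidable using (_×-dec_; ¬?; decidable-stable)

private
  variable
    n : ℕ

edge? : (D : Digraph n) (u v : Fin n) → Dec (Edge D u v)
edge? D u v = D u v ≟ true

outSubset⊎witness : (D : Digraph n) (u v : Fin n) →
                    OutSubset D u v ⊎ ∃[ x ] (Edge D u x × ¬ Edge D v x)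
outSubset⊎witness D u v with any? (λ x → edge? D u x ×-dec ¬? (edge? D v x))
... | yes witness = inj₂ witness
... | no  none    = inj₁ λ x ux →
  decidable-stable (edge? D v x) (λ ¬vx → none (x , ux , ¬vx))

-- (N2) along the cycle gives w → v and t → w, i.e. symmetric edges {w,v} and {w,t}.
4-cycle⇒v≡t : {G : Digraph n} → N2 G → NoAdjacentSymmetric G →
              ∀ {u v w t} → Edge G u v → Edge G v w → Edge G w t → Edge G t u →
              v ≡ t
4-cycle⇒v≡t n2 noAdj {u} {v} {w} {t} uv vw wt tu =
  noAdj w v t (n2 w t u v wt tu uv , vw) (wt , n2 t u v w tu uv vw)

module Orientation {G O : Digraph n} (orientation : IsOrientation G O) where

  private
    ⊆G      = proj₁ orientation
    keeps   = proj₁ (proj₂ orientation)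
    orients = proj₂ (proj₂ orientation)

  dropped⇒reversed : ∀ {u v} → Edge G u v → ¬ Edge O u v → Edge O v u
  dropped⇒reversed {u} {v} uv ¬Ouv with edge? G v u
  ... | no ¬vu = contradiction (keeps u v uv ¬vu) ¬Ouv
  ... | yes vu with orients u v (uv , vu)
  ...   | inj₁ (Ouv , _) = contradiction Ouv ¬Ouv
  ...   | inj₂ (Ovu , _) = Ovu

  nonadjacent⇒nonadjacentᴳ : ∀ {u v} → ¬ Edge O u v → ¬ Edge O v u → ¬ Edge G u v
  nonadjacent⇒nonadjacentᴳ {u} {v} ¬Ouv ¬Ovu uv with edge? O u v
  ... | yes Ouv  = ¬Ouv Ouv
  ... | no ¬Ouv′ = ¬Ovu (dropped⇒reversed uv ¬Ouv′)

  n1ᴼ : N1 G → N1 O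
  n1ᴼ n1 u v (¬Ouv , ¬Ovu) (w , t , Out , Ovw , Otw) =
    n1 u v (nonadjacent⇒nonadjacentᴳ ¬Ouv ¬Ovu , nonadjacent⇒nonadjacentᴳ ¬Ovu ¬Ouv)
       (w , t , ⊆G u t Out , ⊆G v w Ovw , ⊆G t w Otw)

  module _ (n2 : N2 G) (noAdj : NoAdjacentSymmetric G) where

    path⇒edge : ∀ {u v w t} → Edge O u v → Edge G v w → Edge G w t → Edge O u t
    path⇒edge {u} {v} {w} {t} Ouv vw wt with edge? O u t
    ... | yes Out = Out
    ... | no ¬Out = subst (Edge O u) v≡t Ouv
      where
      v≡t : v ≡ t
      v≡t = 4-cycle⇒v≡t n2 noAdj (⊆G u v Ouv) vw wt
              (⊆G t u (dropped⇒reversed (n2 u v w t (⊆G u v Ouv) vw wt) ¬Out))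

    n2ᴼ : N2 O
    n2ᴼ u v w t Ouv Ovw Owt = path⇒edge Ouv (⊆G v w Ovw) (⊆G w t Owt)

    -- If O keeps u → x but drops v → x (an edge of G as N⁺ᴳ(u) ⊆ N⁺ᴳ(v)), it keeps
    -- x → v, so every O-out-neighbour y of v is reached from u along u → x → v → y.
    outSubset⇒outSubsetᴼ : ∀ {u v} → OutSubset G u v → OutSubset O u v ⊎ OutSubset O v u
    outSubset⇒outSubsetᴼ {u} {v} u⊆v with outSubset⊎witness O u v
    ... | inj₁ u⊆ᴼv = inj₁ u⊆ᴼv
    ... | inj₂ (x , Oux , ¬Ovx) = inj₂ λ y Ovy →
      path⇒edge Oux (⊆G x v (dropped⇒reversed (u⊆v x (⊆G u x Oux)) ¬Ovx)) (⊆G v y Ovy)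

    n3ᴼ : N3 G → N3 O
    n3ᴼ n3 u v (w , Ouw , Ovw) with n3 u v (w , ⊆G u w Ouw , ⊆G v w Ovw)
    ... | inj₁ u⊆v = outSubset⇒outSubsetᴼ u⊆v
    ... | inj₂ v⊆u = swap (outSubset⇒outSubsetᴼ v⊆u)

theorem6p1 : (n : ℕ) (G : Digraph n) (c : Coloring n) →
    Is2qBMG G c → NoAdjacentSymmetric G →
    (O : Digraph n) → IsOrientation G O → Is2qBMG O c
theorem6p1 n G c (loopless , colored , n1 , n2 , n3) noAdj O orientation@(⊆G , _) =
  (λ v Ovv → loopless v (⊆G v v Ovv)) ,
  (λ u v Ouv → colored u v (⊆G u v Ouv)) ,
  n1ᴼ n1 ,
  n2ᴼ n2 noAdj ,
  n3ᴼ n2 noAdj n3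
  where open Orientation orientation
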